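{- Let $G$ be a proper circular-arc graph. If the complement $\overline{G}$ is not connected, then $\overline{G}$ is a bipartite permutation graph.
   Context: A proper circular-arc graph is the intersection graph of a family of closed arcs on a circle, none properly containing another. A permutation graph is the intersection graph of a family of line segments each joining a point on one of two fixed parallel lines to a point on the other; a bipartite permutation graph is a permutation graph that is bipartite. -}

module Defs where

open import Data.Nat using (ℕ; suc; _+_; _≤_; _<_; NonZero)
open import Data.Nat.DivMod using (_%_)
open import Data.Fin using (Fin)
open import Data.Bool using (Bool)
open import Data.Product using (Σ; ∃; _×_; _,_)
open import Data.Sum using (_⊎_)
open import Data.Empty using (⊥)
open import Relation.Nullary using (¬_)
open import Relation.Binary.PropositionalEquality using (_≡_; _≢_) renaming (sym to ≡-sym)
open import Function.Bundles using (_⇔_)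

record Graph : Set₁ where
  field
    n     : ℕ
    Adj   : Fin n → Fin n → Set
    adj-sym : ∀ {u v} → Adj u v → Adj v u
    irrefl : ∀ {u} → ¬ Adj u u
open Graph public

complement : Graph → Graph
complement G = record
  { n = n G
  ; Adj = λ u v → (u ≢ v) × ¬ Adj G u v
  ; adj-sym = λ { (u≢v , ¬a) → (λ e → u≢v (≡-sym e)) , (λ a → ¬a (adj-sym G a)) }
  ; irrefl = λ { (u≢u , _) → u≢u _≡_.refl }
  }

data Walk (G : Graph) : Fin (n G) → Fin (n G) → Set where
  here : ∀ {u} → Walk G u u
  step : ∀ {u v w} → Adj G u v → Walk G v w → Walk G u w

Connected : Graph → Set
Connected G = ∀ (u v : Fin (n G)) → Walk G u v

Bipartite : Graph → Set
Bipartite G = Σ (Fin (n G) → Bool) λ c → ∀ {u v} → Adj G u v → c u ≢ c v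

IsIntersectionGraph : {A : Set} → (A → A → Set) → (G : Graph) → (Fin (n G) → A) → Set
IsIntersectionGraph I G f = ∀ (u v : Fin (n G)) → u ≢ v → (Adj G u v ⇔ I (f u) (f v))

record Arc : Set where
  constructor arc
  field
    start : ℕ
    len   : ℕ

-- point x of the circle with m = suc m' points lies on the arc
_∈Arc[_]_ : ℕ → ℕ → Arc → Set
x ∈Arc[ m' ] a = (x < suc m') × ∃ λ k → (k ≤ Arc.len a) × ((Arc.start a + k) % suc m' ≡ x)

ArcsIntersect : ℕ → Arc → Arc → Set
ArcsIntersect m' a b = ∃ λ x → (x ∈Arc[ m' ] a) × (x ∈Arc[ m' ] b)

ProperlyContains : ℕ → Arc → Arc → Set
ProperlyContains m' a b =
  (∀ x → x ∈Arc[ m' ] b → x ∈Arc[ m' ] a) × (∃ λ x → (x ∈Arc[ m' ] a) × ¬ (x ∈Arc[ m' ] b))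

ProperCircularArcGraph : Graph → Set
ProperCircularArcGraph G =
  Σ ℕ λ m' → Σ (Fin (n G) → Arc) λ f →
    IsIntersectionGraph (ArcsIntersect m') G f ×
    (∀ u v → ¬ ProperlyContains m' (f u) (f v))

-- Permutation graphs: a segment joins position `top` on the upper line
-- to position `bot` on the lower line; two closed segments meet iff
-- their endpoint orders are (weakly) reversed.

record Segment : Set where
  constructor seg
  field
    top : ℕ
    bot : ℕ

SegmentsIntersect : Segment → Segment → Set
SegmentsIntersect s t =
  ((Segment.top s ≤ Segment.top t) × (Segment.bot t ≤ Segment.bot s)) ⊎
  ((Segment.top t ≤ Segment.top s) × (Segment.bot s ≤ Segment.bot t))

PermutationGraph : Graph → Set
PermutationGraph G = Σ (Fin (n G) → Segment) λ f → IsIntersectionGraph SegmentsIntersect G f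

BipartitePermutationGraph : Graph → Set
BipartitePermutationGraph G = PermutationGraph G × Bipartite G

{-# OPTIONS --safe #-}
-- Positions on the circle are compared by the clockwise distance δ. Since the complement of G
-- is disconnected, the arcs split into two sides such that every arc meets every arc of the
-- other side; in particular two disjoint arcs u, v lie on the same side. An arc b of the other
-- side meets both and is nested in neither, so it contains the end of one of them, say of u.
-- Let w be the arc of the other side containing en u whose start x lies nearest before en u.
-- An arc avoiding x contains en w if it lies on u's side, and en v otherwise, so the arcs
-- avoiding x pairwise meet, as do the arcs through x: membership of x 2-colours the complement.
-- Measured clockwise from x, an arc avoiding x is an interval [l, r] and an arc through x is
-- the circle minus a gap (A, g]; an avoiding arc misses a through arc iff it lies in its gap,
-- and since no arc is nested in another, nested coordinates force equal arcs. Hence the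
-- segments from 2A+1 to 2g+1 and from 2l to 2r, with ties broken by vertex index, realise the
-- complement as a permutation graph; arcs meeting all others become far-away parallel segments.
module Submission where

open import Data.Nat
open import Data.Nat.Properties
open import Algebra.Properties.CommutativeSemigroup +-commutativeSemigroup using (x∙yz≈y∙xz)
open import Data.Nat.DivMod
open import Data.Sum using (_⊎_; inj₁; inj₂; [_,_]′)
open import Data.Product using (∃; _×_; _,_; proj₁; proj₂)
import Data.Product as Product
open import Data.Empty using (⊥; ⊥-elim)
open import Data.Bool using (Bool)
import Data.Bool.Properties as Bool
open import Data.Fin using (Fin; toℕ) renaming (_≟_ to _≟ᶠ_)
open import Data.Fin.Properties using (any?; all?; ¬∀⟶∃¬; toℕ<n; toℕ-injective)
open import Data.Fin.Subset using (Subset; _∈_; _∉_; _∪_; ⁅_⁆; _⊃_)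
open import Data.Fin.Subset.Properties using (_∈?_; p⊆p∪q; x∈p∪q⁺; x∈p∪q⁻; x∈⁅x⁆; x∈⁅y⁆⇒x≡y)
open import Data.Fin.Subset.Induction using (⊃-wellFounded)
open import Induction.WellFounded using (Acc; acc)
open import Function using (_∘_)
open import Function.Bundles using (_⇔_; mk⇔; Equivalence)
open import Function.Properties.Equivalence using () renaming (trans to ⇔-trans)
open import Relation.Nullary using (¬_; yes; no; Dec; does; map′; _×-dec_; ¬?)
open import Relation.Nullary.Decidable using (decidable-stable)
open import Relation.Binary.PropositionalEquality
open import Data.List using (filter; allFin)
open import Data.List.Extrema.Nat using (argmin; argmin-all; f[argmin]≤f[xs])
open import Data.List.Membership.Propositional.Properties using (∈-filter⁺; ∈-allFin)
import Data.List.Relation.Unary.All as All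
open import Data.List.Relation.Unary.All.Properties using (all-filter)
open import Relation.Unary using (Pred; Decidable)
open import Defs

module Circle (m′ : ℕ) where

  M : ℕ
  M = suc m′

  data Lands (p d z : ℕ) : Set where
    direct  : p + d ≡ z → Lands p d z
    wrapped : p + d ≡ M + z → Lands p d z

  -- Everything below uses δ only through δ-lands and δ<M; unfolding its case split inside
  -- types makes elaboration very slow.
  opaque
    δ : ℕ → ℕ → ℕ
    δ p z with p ≤? z
    ... | yes _ = z ∸ p
    ... | no  _ = M + z ∸ p

    δ-lands : ∀ {p z} → p < M → Lands p (δ p z) z
    δ-lands {p} {z} p<M with p ≤? z
    ... | yes p≤z = direct (m+[n∸m]≡n p≤z)
    ... | no  _   = wrapped (m+[n∸m]≡n (≤-trans (<⇒≤ p<M) (m≤m+n M z)))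

    δ<M : ∀ {p z} → p < M → z < M → δ p z < M
    δ<M {p} {z} p<M z<M with p ≤? z
    ... | yes _   = ≤-<-trans (m∸n≤m z p) z<M
    ... | no  p≰z = subst (M + z ∸ p <_) (m+n∸n≡m M z)
                      (∸-monoʳ-< (≰⇒> p≰z) (≤-trans (<⇒≤ p<M) (m≤m+n M z)))

  landing-twice : ∀ {p d e z} → e < M → p + d ≡ z → p + e ≡ M + z → ⊥
  landing-twice {p} {d} {e} {z} e<M p+d≡z p+e≡M+z =
    <⇒≱ e<M (subst (M ≤_) (sym e≡M+d) (m≤m+n M d))
    where
      open ≡-Reasoning
      e≡M+d : e ≡ M + d
      e≡M+d = +-cancelˡ-≡ p e (M + d) (begin
        p + e       ≡⟨ p+e≡M+z ⟩
        M + z       ≡⟨ cong (M +_) (sym p+d≡z) ⟩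
        M + (p + d) ≡⟨ x∙yz≈y∙xz M p d ⟩
        p + (M + d) ∎)

  lands-unique : ∀ {p d e z} → d < M → e < M → Lands p d z → Lands p e z → d ≡ e
  lands-unique {p} _ _ (direct p+d≡z) (direct p+e≡z) = +-cancelˡ-≡ p _ _ (trans p+d≡z (sym p+e≡z))
  lands-unique {p} _ _ (wrapped p+d≡M+z) (wrapped p+e≡M+z) = +-cancelˡ-≡ p _ _ (trans p+d≡M+z (sym p+e≡M+z))
  lands-unique _ e<M (direct p+d≡z) (wrapped p+e≡M+z) = ⊥-elim (landing-twice e<M p+d≡z p+e≡M+z)
  lands-unique d<M _ (wrapped p+d≡M+z) (direct p+e≡z) = ⊥-elim (landing-twice d<M p+e≡z p+d≡M+z)

  δ-unique : ∀ {p d z} → p < M → z < M → d < M → Lands p d z → δ p z ≡ d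
  δ-unique p<M z<M d<M = lands-unique (δ<M p<M z<M) d<M (δ-lands p<M)

  lands-trans : ∀ {p q r d e} → Lands p d q → Lands q e r →
                p + (d + e) ≡ r ⊎ p + (d + e) ≡ M + r ⊎ p + (d + e) ≡ M + (M + r)
  lands-trans {p} {q} {r} {d} {e} = combine
    where
      via : ∀ {q′ r′} → p + d ≡ q′ → q′ + e ≡ r′ → p + (d + e) ≡ r′
      via p+d≡q′ q′+e≡r′ = trans (sym (+-assoc p d e)) (trans (cong (_+ e) p+d≡q′) q′+e≡r′)
      turn : ∀ {r′} → q + e ≡ r′ → M + q + e ≡ M + r′
      turn q+e≡r′ = trans (+-assoc M q e) (cong (M +_) q+e≡r′)
      combine : Lands p d q → Lands q e r →
                p + (d + e) ≡ r ⊎ p + (d + e) ≡ M + r ⊎ p + (d + e) ≡ M + (M + r)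
      combine (direct  p+d≡q)   (direct  q+e≡r)   = inj₁ (via p+d≡q q+e≡r)
      combine (direct  p+d≡q)   (wrapped q+e≡M+r) = inj₂ (inj₁ (via p+d≡q q+e≡M+r))
      combine (wrapped p+d≡M+q) (direct  q+e≡r)   = inj₂ (inj₁ (via p+d≡M+q (turn q+e≡r)))
      combine (wrapped p+d≡M+q) (wrapped q+e≡M+r) = inj₂ (inj₂ (via p+d≡M+q (turn q+e≡M+r)))

  δ-add : ∀ {p q r} → p < M → q < M → r < M →
          δ p q + δ q r ≡ δ p r ⊎ δ p q + δ q r ≡ M + δ p r
  δ-add {p} {q} {r} p<M q<M r<M with δ p q + δ q r <? M | lands-trans (δ-lands p<M) (δ-lands q<M)
  ... | yes s<M | inj₁ landed          = inj₁ (sym (δ-unique p<M r<M s<M (direct landed)))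
  ... | yes s<M | inj₂ (inj₁ landed)   = inj₁ (sym (δ-unique p<M r<M s<M (wrapped landed)))
  ... | yes s<M | inj₂ (inj₂ landed)   =
    ⊥-elim (<⇒≱ (+-mono-< p<M s<M) (subst (M + M ≤_) (sym landed) (+-monoʳ-≤ M (m≤m+n M r))))
  ... | no  s≮M | landed = inj₂ (trans (sym M+e≡s) (cong (M +_) (sym (δ-unique p<M r<M e<M (unwrap landed)))))
    where
      s = δ p q + δ q r
      e = s ∸ M
      M+e≡s : M + e ≡ s
      M+e≡s = m+[n∸m]≡n (≮⇒≥ s≮M)
      e<M : e < M
      e<M = +-cancelˡ-< M e M (subst (_< M + M) (sym M+e≡s) (+-mono-< (δ<M p<M q<M) (δ<M q<M r<M)))
      p+s≡M+[p+e] : p + s ≡ M + (p + e)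
      p+s≡M+[p+e] = trans (cong (p +_) (sym M+e≡s)) (x∙yz≈y∙xz p M e)
      unwrap : p + s ≡ r ⊎ p + s ≡ M + r ⊎ p + s ≡ M + (M + r) → Lands p e r
      unwrap (inj₁ p+s≡r) = ⊥-elim (<⇒≱ r<M (subst (M ≤_) p+s≡r (≤-trans (≮⇒≥ s≮M) (m≤n+m s p))))
      unwrap (inj₂ (inj₁ p+s≡M+r)) = direct (+-cancelˡ-≡ M _ _ (trans (sym p+s≡M+[p+e]) p+s≡M+r))
      unwrap (inj₂ (inj₂ p+s≡2M+r)) = wrapped (+-cancelˡ-≡ M _ _ (trans (sym p+s≡M+[p+e]) p+s≡2M+r))

  δ-self : ∀ {p} → p < M → δ p p ≡ 0
  δ-self p<M = δ-unique p<M p<M z<s (direct (+-identityʳ _))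

  δ-split : ∀ {p q r} → p < M → q < M → r < M → δ p q ≤ δ p r → δ p q + δ q r ≡ δ p r
  δ-split {p} {q} {r} p<M q<M r<M pq≤pr with δ-add p<M q<M r<M
  ... | inj₁ added   = added
  ... | inj₂ went-round = ⊥-elim (<⇒≱ (δ<M q<M r<M) (+-cancelˡ-≤ (δ p q) M (δ q r) (begin
    δ p q + M ≡⟨ +-comm (δ p q) M ⟩
    M + δ p q ≤⟨ +-monoʳ-≤ M pq≤pr ⟩
    M + δ p r ≡⟨ sym went-round ⟩
    δ p q + δ q r ∎)))
    where open ≤-Reasoning

  δ-triangle : ∀ {p q r} → p < M → q < M → r < M → δ p r ≤ δ p q + δ q r
  δ-triangle {p} {q} {r} p<M q<M r<M with δ-add p<M q<M r<M
  ... | inj₁ added   = ≤-reflexive (sym added)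
  ... | inj₂ went-round = subst (δ p r ≤_) (sym went-round) (m≤n+m (δ p r) M)

  infixl 6 _⊕_

  _⊕_ : ℕ → ℕ → ℕ
  p ⊕ c = (p + c) % M

  ⊕<M : ∀ p c → p ⊕ c < M
  ⊕<M p c = m%n<n (p + c) M

  lands-% : ∀ {p d} → p + d < M + M → Lands p d (p ⊕ d)
  lands-% {p} {d} t<2M with p + d <? M
  ... | yes t<M = direct (sym (m<n⇒m%n≡m t<M))
  ... | no  t≮M = wrapped (begin
    p + d                ≡⟨ sym (m+[n∸m]≡n M≤t) ⟩
    M + (p + d ∸ M)      ≡⟨ cong (M +_) (sym (m<n⇒m%n≡m t∸M<M)) ⟩
    M + (p + d ∸ M) % M  ≡⟨ cong (M +_) (m≤n⇒[n∸m]%m≡n%m M≤t) ⟩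
    M + (p + d) % M      ∎)
    where
      open ≡-Reasoning
      M≤t : M ≤ p + d
      M≤t = ≮⇒≥ t≮M
      t∸M<M : p + d ∸ M < M
      t∸M<M = subst (p + d ∸ M <_) (m+n∸n≡m M M) (∸-monoˡ-< t<2M M≤t)

  ⊕-% : ∀ {p} c → p < M → p ⊕ c ≡ p ⊕ (c % M)
  ⊕-% {p} c p<M = trans (%-distribˡ-+ p c M) (cong (λ p′ → (p′ + c % M) % M) (m<n⇒m%n≡m p<M))

  δ-⊕ : ∀ {p} c → p < M → δ p (p ⊕ c) ≡ c % M
  δ-⊕ {p} c p<M = δ-unique p<M (⊕<M p c) (m%n<n c M)
    (subst (Lands p (c % M)) (sym (⊕-% c p<M)) (lands-% (+-mono-< p<M (m%n<n c M))))

  δ-⊕-< : ∀ {p c} → p < M → c < M → δ p (p ⊕ c) ≡ c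
  δ-⊕-< {c = c} p<M c<M = trans (δ-⊕ c p<M) (m<n⇒m%n≡m c<M)

  ⊕-δ : ∀ {p z} → p < M → z < M → p ⊕ δ p z ≡ z
  ⊕-δ {p} {z} p<M z<M with δ-lands {z = z} p<M
  ... | direct p+δ≡z = trans (cong (_% M) p+δ≡z) (m<n⇒m%n≡m z<M)
  ... | wrapped p+δ≡M+z = begin
    (p + δ p z) % M ≡⟨ cong (_% M) (trans p+δ≡M+z (+-comm M z)) ⟩
    (z + M) % M     ≡⟨ [m+n]%n≡m%n z M ⟩
    z % M           ≡⟨ m<n⇒m%n≡m z<M ⟩
    z               ∎
    where open ≡-Reasoning

module Arcs (m′ : ℕ) where
  open Circle m′ public

  st : Arc → ℕ
  st a = Arc.start a % M

  st<M : ∀ a → st a < M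
  st<M a = m%n<n (Arc.start a) M

  en : Arc → ℕ
  en a = st a ⊕ Arc.len a

  en<M : ∀ a → en a < M
  en<M a = ⊕<M (st a) (Arc.len a)

  infix 4 _∈ᵃ_ _∉ᵃ_ _⊆ᵃ_ _⊂ᵃ_

  -- A record rather than a product, so that the arc can be inferred from a membership proof.
  record _∈ᵃ_ (z : ℕ) (a : Arc) : Set where
    constructor mk∈
    field
      on-circle : z < M
      within    : δ (st a) z ≤ Arc.len a
  open _∈ᵃ_ public

  _∉ᵃ_ : ℕ → Arc → Set
  z ∉ᵃ a = ¬ z ∈ᵃ a

  _∈ᵃ?_ : ∀ z a → Dec (z ∈ᵃ a)
  z ∈ᵃ? a = map′ (λ (z<M , w) → mk∈ z<M w) (λ z∈a → on-circle z∈a , within z∈a)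
                 (z <? M ×-dec δ (st a) z ≤? Arc.len a)

  st∈ : ∀ a → st a ∈ᵃ a
  st∈ a = mk∈ (st<M a) (subst (_≤ Arc.len a) (sym (δ-self (st<M a))) z≤n)

  en∈ : ∀ a → en a ∈ᵃ a
  en∈ a = mk∈ (en<M a) (subst (_≤ Arc.len a) (sym (δ-⊕ (Arc.len a) (st<M a))) (m%n≤m (Arc.len a) M))

  %-⊕ : ∀ s k → (s + k) % M ≡ (s % M) ⊕ k
  %-⊕ s k = begin
    (s + k) % M               ≡⟨ %-distribˡ-+ s k M ⟩
    (s % M + k % M) % M       ≡⟨ cong (λ s′ → (s′ + k % M) % M) (sym (m%n%n≡m%n s M)) ⟩
    (s % M % M + k % M) % M   ≡⟨ sym (%-distribˡ-+ (s % M) k M) ⟩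
    (s % M + k) % M           ∎
    where open ≡-Reasoning

  ∈ᵃ⇔∈Arc : ∀ {z a} → z ∈ᵃ a ⇔ z ∈Arc[ m′ ] a
  ∈ᵃ⇔∈Arc {z} {a} = mk⇔ to from
    where
      to : z ∈ᵃ a → z ∈Arc[ m′ ] a
      to (mk∈ z<M within) = z<M , δ (st a) z , within ,
        trans (%-⊕ (Arc.start a) (δ (st a) z)) (⊕-δ (st<M a) z<M)
      from : z ∈Arc[ m′ ] a → z ∈ᵃ a
      from (z<M , k , k≤len , start+k≡z) = mk∈ z<M (begin
        δ (st a) z              ≡⟨ cong (δ (st a)) (trans (sym start+k≡z) (%-⊕ (Arc.start a) k)) ⟩
        δ (st a) (st a ⊕ k)     ≡⟨ δ-⊕ k (st<M a) ⟩
        k % M                   ≤⟨ m%n≤m k M ⟩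
        k                       ≤⟨ k≤len ⟩
        Arc.len a               ∎)
        where open ≤-Reasoning

  Meet : Arc → Arc → Set
  Meet a b = ∃ λ z → z ∈ᵃ a × z ∈ᵃ b

  meet? : ∀ a b → Dec (Meet a b)
  meet? a b = map′ (λ (z , _ , z∈ab) → z , z∈ab) (λ (z , z∈a , z∈b) → z , on-circle z∈a , z∈a , z∈b)
                   (anyUpTo? (λ z → z ∈ᵃ? a ×-dec z ∈ᵃ? b) M)

  meet-sym : ∀ {a b} → Meet a b → Meet b a
  meet-sym (z , z∈a , z∈b) = z , z∈b , z∈a

  meet⇔ArcsIntersect : ∀ {a b} → Meet a b ⇔ ArcsIntersect m′ a b
  meet⇔ArcsIntersect = mk⇔
    (λ (z , z∈a , z∈b) → z , Equivalence.to ∈ᵃ⇔∈Arc z∈a , Equivalence.to ∈ᵃ⇔∈Arc z∈b)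
    (λ (z , z∈a , z∈b) → z , Equivalence.from ∈ᵃ⇔∈Arc z∈a , Equivalence.from ∈ᵃ⇔∈Arc z∈b)

  _⊆ᵃ_ : Arc → Arc → Set
  a ⊆ᵃ b = ∀ {z} → z ∈ᵃ a → z ∈ᵃ b

  _⊂ᵃ_ : Arc → Arc → Set
  a ⊂ᵃ b = a ⊆ᵃ b × ∃ λ z → z ∈ᵃ b × z ∉ᵃ a

  ⊂ᵃ⇒ProperlyContains : ∀ {a b} → a ⊂ᵃ b → ProperlyContains m′ b a
  ⊂ᵃ⇒ProperlyContains (a⊆b , z , z∈b , z∉a) =
    (λ _ y∈a → Equivalence.to ∈ᵃ⇔∈Arc (a⊆b (Equivalence.from ∈ᵃ⇔∈Arc y∈a))) ,
    z , Equivalence.to ∈ᵃ⇔∈Arc z∈b , λ z∈a → z∉a (Equivalence.from ∈ᵃ⇔∈Arc z∈a)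

  module Avoiding {x} (a : Arc) (x<M : x < M) (x∉a : x ∉ᵃ a) where

    l : ℕ
    l = δ x (st a)

    r : ℕ
    r = l + Arc.len a

    r<M : r < M
    r<M with δ-add x<M (st<M a) x<M
    ... | inj₁ returned = ⊥-elim (x∉a (mk∈ x<M (subst (_≤ Arc.len a) (sym δ≡0) z≤n)))
      where
        δ≡0 : δ (st a) x ≡ 0
        δ≡0 = m+n≡0⇒n≡0 l (trans returned (δ-self x<M))
    ... | inj₂ went-round = begin-strict
      l + Arc.len a     <⟨ +-monoʳ-< l (≰⇒> (λ within → x∉a (mk∈ x<M within))) ⟩
      l + δ (st a) x    ≡⟨ went-round ⟩
      M + δ x x         ≡⟨ cong (M +_) (δ-self x<M) ⟩
      M + 0             ≡⟨ +-identityʳ M ⟩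
      M                 ∎
      where open ≤-Reasoning

    ∈⇒between : ∀ {z} → z ∈ᵃ a → l ≤ δ x z × δ x z ≤ r
    ∈⇒between (mk∈ z<M within) with δ-add x<M (st<M a) z<M
    ... | inj₁ added = subst (l ≤_) added (m≤m+n l _) , subst (_≤ r) added (+-monoʳ-≤ l within)
    ... | inj₂ went-round = ⊥-elim (<⇒≱ r<M (begin
      M                  ≤⟨ m≤m+n M _ ⟩
      M + δ x _          ≡⟨ sym went-round ⟩
      l + δ (st a) _     ≤⟨ +-monoʳ-≤ l within ⟩
      r                  ∎))
      where open ≤-Reasoning

    between⇒∈ : ∀ {z} → z < M → l ≤ δ x z → δ x z ≤ r → z ∈ᵃ a
    between⇒∈ {z} z<M l≤ ≤r with δ-add x<M (st<M a) z<M
    ... | inj₁ added = mk∈ z<M (+-cancelˡ-≤ l _ _ (subst (_≤ r) (sym added) ≤r))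
    ... | inj₂ went-round = ⊥-elim (<⇒≱ (δ<M (st<M a) z<M) (+-cancelˡ-≤ l M _ (begin
      l + M              ≡⟨ +-comm l M ⟩
      M + l              ≤⟨ +-monoʳ-≤ M l≤ ⟩
      M + δ x z          ≡⟨ sym went-round ⟩
      l + δ (st a) z     ∎)))
      where open ≤-Reasoning

    ⊕∈⇔ : ∀ {c} → c < M → x ⊕ c ∈ᵃ a ⇔ (l ≤ c × c ≤ r)
    ⊕∈⇔ {c} c<M = mk⇔ (subst (λ d → l ≤ d × d ≤ r) δc ∘ ∈⇒between)
                      (λ (l≤c , c≤r) → between⇒∈ (⊕<M x c) (subst (l ≤_) (sym δc) l≤c)
                                                             (subst (_≤ r) (sym δc) c≤r))
      where
        δc : δ x (x ⊕ c) ≡ c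
        δc = δ-⊕-< x<M c<M

  -- Measured clockwise from x, an arc through x is the circle minus the gap (A, g].
  module Through {x} (a : Arc) (x∈a : x ∈ᵃ a) where

    α : ℕ
    α = δ (st a) x

    A : ℕ
    A = Arc.len a ∸ α

    g : ℕ
    g = m′ ∸ α

    α+A≡len : α + A ≡ Arc.len a
    α+A≡len = m+[n∸m]≡n (within x∈a)

    α+g≡m′ : α + g ≡ m′
    α+g≡m′ = m+[n∸m]≡n (s≤s⁻¹ (δ<M (st<M a) (on-circle x∈a)))

    M≤α+y⇔g<y : ∀ {y} → M ≤ α + y ⇔ g < y
    M≤α+y⇔g<y {y} = mk⇔
      (λ M≤ → +-cancelˡ-≤ α _ _ (subst (_≤ α + y) (trans (cong suc (sym α+g≡m′)) (sym (+-suc α g))) M≤))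
      (λ g<y → subst (_≤ α + y) (trans (+-suc α g) (cong suc α+g≡m′)) (+-monoʳ-≤ α g<y))

    ∈⇒outside-gap : ∀ {z} → z ∈ᵃ a → δ x z ≤ A ⊎ g < δ x z
    ∈⇒outside-gap (mk∈ z<M within) with δ-add (st<M a) (on-circle x∈a) z<M
    ... | inj₁ added = inj₁ (+-cancelˡ-≤ α _ _ (subst₂ _≤_ (sym added) (sym α+A≡len) within))
    ... | inj₂ went-round = inj₂ (Equivalence.to M≤α+y⇔g<y (subst (M ≤_) (sym went-round) (m≤m+n M _)))

    outside-gap⇒∈ : ∀ {z} → z < M → δ x z ≤ A ⊎ g < δ x z → z ∈ᵃ a
    outside-gap⇒∈ {z} z<M (inj₁ ≤A) = mk∈ z<M (begin
      δ (st a) z         ≤⟨ δ-triangle (st<M a) (on-circle x∈a) z<M ⟩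
      α + δ x z          ≤⟨ +-monoʳ-≤ α ≤A ⟩
      α + A              ≡⟨ α+A≡len ⟩
      Arc.len a          ∎)
      where open ≤-Reasoning
    outside-gap⇒∈ {z} z<M (inj₂ g<) with δ-add (st<M a) (on-circle x∈a) z<M
    ... | inj₁ added = ⊥-elim (<⇒≱ (δ<M (st<M a) z<M) (subst (M ≤_) added (Equivalence.from M≤α+y⇔g<y g<)))
    ... | inj₂ went-round = mk∈ z<M (≤-trans (<⇒≤ (+-cancelˡ-< M _ _ (begin-strict
      M + δ (st a) z     ≡⟨ sym went-round ⟩
      α + δ x z          <⟨ +-monoʳ-< α (δ<M (on-circle x∈a) z<M) ⟩
      α + M              ≡⟨ +-comm α M ⟩
      M + α              ∎))) (within x∈a))
      where open ≤-Reasoning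

    ⊕∈⇔ : ∀ {c} → c < M → x ⊕ c ∈ᵃ a ⇔ (c ≤ A ⊎ g < c)
    ⊕∈⇔ {c} c<M = mk⇔ (subst (λ d → d ≤ A ⊎ g < d) δc ∘ ∈⇒outside-gap)
                      (outside-gap⇒∈ (⊕<M x c) ∘ subst (λ d → d ≤ A ⊎ g < d) (sym δc))
      where
        δc : δ x (x ⊕ c) ≡ c
        δc = δ-⊕-< (on-circle x∈a) c<M

    g<M : g < M
    g<M = s≤s (m∸n≤m m′ α)

    A<g : Arc.len a < m′ → A < g
    A<g len<m′ = ∸-monoˡ-< len<m′ (within x∈a)

  meet-endpoint : ∀ {a w} → Meet a w → ¬ a ⊂ᵃ w → st w ∈ᵃ a ⊎ en w ∈ᵃ a
  meet-endpoint {a} {w} (z , z∈a , z∈w) a⊄w with st w ∈ᵃ? a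
  ... | yes sw∈a = inj₁ sw∈a
  ... | no  sw∉a =
    inj₂ (between⇒∈ (en<M w) (subst (l ≤_) (sym δ-en) l≤len) (subst (_≤ r) (sym δ-en) (<⇒≤ len<r)))
    where
      open Avoiding a (st<M w) sw∉a
      len<r : Arc.len w < r
      len<r = ≰⇒> λ r≤len →
        a⊄w ((λ y∈a → mk∈ (on-circle y∈a) (≤-trans (proj₂ (∈⇒between y∈a)) r≤len)) , st w , st∈ w , sw∉a)
      δ-en : δ (st w) (en w) ≡ Arc.len w
      δ-en = δ-⊕-< (st<M w) (<-trans len<r r<M)
      l≤len : l ≤ Arc.len w
      l≤len = ≤-trans (proj₁ (∈⇒between z∈a)) (within z∈w)

  ∈ᵃ-convex : ∀ {y z b} → y < M → z ∈ᵃ b → δ y z ≤ δ (st b) z → y ∈ᵃ b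
  ∈ᵃ-convex {y} {z} {b} y<M (mk∈ z<M within) yz≤bz with δ-add (st<M b) y<M z<M
  ... | inj₁ added = mk∈ y<M (≤-trans (m≤m+n _ _) (≤-trans (≤-reflexive added) within))
  ... | inj₂ went-round = ⊥-elim (<⇒≱ (δ<M (st<M b) y<M) (+-cancelʳ-≤ (δ y z) M _ (begin
    M + δ y z          ≤⟨ +-monoʳ-≤ M yz≤bz ⟩
    M + δ (st b) z     ≡⟨ sym went-round ⟩
    δ (st b) y + δ y z ∎)))
    where open ≤-Reasoning

  later-start∈ : ∀ {b u v} → st u ∈ᵃ b → st v ∈ᵃ b → en u ∉ᵃ b →
                 δ (st b) (st u) ≤ δ (st b) (st v) → st v ∈ᵃ u
  later-start∈ {b} {u} {v} (mk∈ _ bu≤len) (mk∈ _ bv≤len) eu∉b bu≤bv =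
    mk∈ (st<M v) (≤-trans (<⇒≤ (+-cancelˡ-< (δ sb su) _ _ (begin-strict
      δ sb su + δ su sv  ≡⟨ δ-split (st<M b) (st<M u) (st<M v) bu≤bv ⟩
      δ sb sv            ≤⟨ bv≤len ⟩
      Arc.len b          <⟨ ≰⇒> (λ within → eu∉b (mk∈ (en<M u) within)) ⟩
      δ sb (en u)        ≤⟨ δ-triangle (st<M b) (st<M u) (en<M u) ⟩
      δ sb su + δ su (en u) ∎))) (within (en∈ u)))
    where
      open ≤-Reasoning
      sb = st b
      su = st u
      sv = st v

  bridge-end : ∀ {b u v} → Meet b u → Meet b v → ¬ Meet u v → ¬ b ⊂ᵃ u → ¬ b ⊂ᵃ v →
               en u ∈ᵃ b ⊎ en v ∈ᵃ b
  bridge-end {b} {u} {v} bu bv u∩v≡∅ b⊄u b⊄v with meet-endpoint bu b⊄u | meet-endpoint bv b⊄v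
  ... | inj₂ eu∈b | _         = inj₁ eu∈b
  ... | inj₁ _    | inj₂ ev∈b = inj₂ ev∈b
  ... | inj₁ su∈b | inj₁ sv∈b with en u ∈ᵃ? b | en v ∈ᵃ? b
  ...   | yes eu∈b | _        = inj₁ eu∈b
  ...   | no  _    | yes ev∈b = inj₂ ev∈b
  ...   | no  eu∉b | no ev∉b  with ≤-total (δ (st b) (st u)) (δ (st b) (st v))
  ...     | inj₁ bu≤bv = ⊥-elim (u∩v≡∅ (st v , later-start∈ {u = u} {v} su∈b sv∈b eu∉b bu≤bv , st∈ v))
  ...     | inj₂ bv≤bu = ⊥-elim (u∩v≡∅ (st u , st∈ u , later-start∈ {u = v} {u} sv∈b su∈b ev∉b bv≤bu))

module Separations (H : Graph) (adj? : ∀ u v → Dec (Adj H u v)) where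

  Closed : Subset (n H) → Set
  Closed C = ∀ {a b} → a ∈ C → Adj H a b → b ∈ C

  record Component (t : Fin (n H)) : Set where
    field
      members : Subset (n H)
      t∈      : t ∈ members
      closed  : Closed members
      reaches : ∀ {b} → b ∈ members → Walk H b t

  grow : ∀ {t} (C : Subset (n H)) → Acc _⊃_ C → t ∈ C → (∀ {b} → b ∈ C → Walk H b t) → Component t
  grow C (acc larger) t∈C reaches with any? (λ b → ¬? (b ∈? C) ×-dec any? (λ a → a ∈? C ×-dec adj? a b))
  ... | no no-exit = record { members = C ; t∈ = t∈C ; closed = closed ; reaches = reaches }
    where
      closed : Closed C
      closed {a} {b} a∈C a~b with b ∈? C
      ... | yes b∈C = b∈C
      ... | no  b∉C = ⊥-elim (no-exit (b , b∉C , a , a∈C , a~b))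
  ... | yes (b , b∉C , a , a∈C , a~b) =
    grow (C ∪ ⁅ b ⁆) (larger (p⊆p∪q ⁅ b ⁆ , b , x∈p∪q⁺ (inj₂ (x∈⁅x⁆ b)) , b∉C))
         (p⊆p∪q ⁅ b ⁆ t∈C) reaches′
    where
      reaches′ : ∀ {c} → c ∈ C ∪ ⁅ b ⁆ → Walk H c _
      reaches′ c∈ with x∈p∪q⁻ C ⁅ b ⁆ c∈
      ... | inj₁ c∈C  = reaches c∈C
      ... | inj₂ c∈⁅b⁆ =
        subst (λ c → Walk H c _) (sym (x∈⁅y⁆⇒x≡y b c∈⁅b⁆)) (step (adj-sym H a~b) (reaches a∈C))

  component : ∀ t → Component t
  component t = grow ⁅ t ⁆ (⊃-wellFounded ⁅ t ⁆) (x∈⁅x⁆ t)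
    (λ b∈⁅t⁆ → subst (λ b → Walk H b t) (sym (x∈⁅y⁆⇒x≡y t b∈⁅t⁆)) here)

  record Separation : Set where
    field
      side        : Fin (n H) → Bool
      opposite    : ∀ u → ∃ λ v → side v ≢ side u
      no-crossing : ∀ {a c} → side a ≢ side c → ¬ Adj H a c

  component-separation : ∀ {t b} → b ∉ Component.members (component t) → Separation
  component-separation {t} {b} b∉C = record { side = side ; opposite = opposite ; no-crossing = no-crossing }
    where
      open Component (component t)
      side : Fin (n H) → Bool
      side v = does (v ∈? members)
      t≢b : side t ≢ side b
      t≢b with t ∈? members | b ∈? members
      ... | yes _   | no _   = λ ()
      ... | no t∉C  | _      = ⊥-elim (t∉C t∈)
      ... | _       | yes b∈C = ⊥-elim (b∉C b∈C)
      opposite : ∀ u → ∃ λ v → side v ≢ side u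
      opposite u with side u Bool.≟ side t
      ... | yes u≡t = b , λ b≡u → t≢b (sym (trans b≡u u≡t))
      ... | no  u≢t = t , λ t≡u → u≢t (sym t≡u)
      no-crossing : ∀ {a c} → side a ≢ side c → ¬ Adj H a c
      no-crossing {a} {c} sides a~c with a ∈? members | c ∈? members
      ... | yes _   | yes _   = sides refl
      ... | no _    | no _    = sides refl
      ... | yes a∈C | no c∉C  = c∉C (closed a∈C a~c)
      ... | no a∉C  | yes c∈C = a∉C (closed c∈C (adj-sym H a~c))

  disconnected⇒separation : ¬ Connected H → Separation
  disconnected⇒separation ¬connected with all? (λ t → all? (λ b → b ∈? Component.members (component t)))
  ... | yes all∈ = ⊥-elim (¬connected (λ u v → Component.reaches (component v) (all∈ v u)))
  ... | no ¬all∈ with ¬∀⟶∃¬ _ _ (λ t → all? (λ b → b ∈? Component.members (component t))) ¬all∈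
  ...   | t , ¬all∈t with ¬∀⟶∃¬ _ _ (λ b → b ∈? Component.members (component t)) ¬all∈t
  ...     | b , b∉C = component-separation b∉C

segments-intersect-sym : ∀ {s t} → SegmentsIntersect s t → SegmentsIntersect t s
segments-intersect-sym (inj₁ crossing) = inj₂ crossing
segments-intersect-sym (inj₂ crossing) = inj₁ crossing

Isolated : (H : Graph) → Fin (n H) → Set
Isolated H w = ∀ v → ¬ Adj H w v

Below : ℕ → Segment → Set
Below N s = Segment.top s < N × Segment.bot s < N

permutation-graph-off-isolated :
  (H : Graph) → (∀ w → Dec (Isolated H w)) → (s : Fin (n H) → Segment) (N : ℕ) →
  (∀ {w} → ¬ Isolated H w → Below N (s w)) →
  (∀ {u v} → u ≢ v → ¬ Isolated H u → ¬ Isolated H v → Adj H u v ⇔ SegmentsIntersect (s u) (s v)) →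
  PermutationGraph H
permutation-graph-off-isolated H isolated? s N below model =
  (λ w → place w (isolated? w)) , λ u v u≢v → placed u≢v (isolated? u) (isolated? v)
  where
    place : ∀ w → Dec (Isolated H w) → Segment
    place w (yes _) = seg (N + toℕ w) (N + toℕ w)
    place w (no  _) = s w

    far-from : ∀ {t} i → Below N t → ¬ SegmentsIntersect (seg (N + i) (N + i)) t
    far-from i (top<N , _) (inj₁ (N+i≤top , _)) = <⇒≱ top<N (≤-trans (m≤m+n N i) N+i≤top)
    far-from i (_ , bot<N) (inj₂ (_ , N+i≤bot)) = <⇒≱ bot<N (≤-trans (m≤m+n N i) N+i≤bot)

    far-apart : ∀ {u v : Fin (n H)} → u ≢ v →
                ¬ SegmentsIntersect (seg (N + toℕ u) (N + toℕ u)) (seg (N + toℕ v) (N + toℕ v))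
    far-apart u≢v (inj₁ (u≤v , v≤u)) =
      u≢v (toℕ-injective (≤-antisym (+-cancelˡ-≤ N _ _ u≤v) (+-cancelˡ-≤ N _ _ v≤u)))
    far-apart u≢v (inj₂ (v≤u , u≤v)) =
      u≢v (toℕ-injective (≤-antisym (+-cancelˡ-≤ N _ _ u≤v) (+-cancelˡ-≤ N _ _ v≤u)))

    placed : ∀ {u v} → u ≢ v → (du : Dec (Isolated H u)) (dv : Dec (Isolated H v)) →
             Adj H u v ⇔ SegmentsIntersect (place u du) (place v dv)
    placed u≢v (no ¬iu) (no ¬iv) = model u≢v ¬iu ¬iv
    placed u≢v (yes iu) (yes _)  = mk⇔ (λ u~v → ⊥-elim (iu _ u~v))
                                       (λ crossing → ⊥-elim (far-apart u≢v crossing))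
    placed u≢v (yes iu) (no ¬iv) = mk⇔ (λ u~v → ⊥-elim (iu _ u~v))
                                       (λ crossing → ⊥-elim (far-from _ (below ¬iv) crossing))
    placed u≢v (no ¬iu) (yes iv) = mk⇔ (λ u~v → ⊥-elim (iv _ (adj-sym H u~v)))
      (λ crossing → ⊥-elim (far-from _ (below ¬iu) (segments-intersect-sym crossing)))

module Codes (k : ℕ) where

  -- Equal keys are ordered by vertex index, so distinct vertices never share an endpoint.
  code : ℕ → Fin k → ℕ
  code T i = k * T + toℕ i

  code<k*[1+T] : ∀ T i → code T i < k * suc T
  code<k*[1+T] T i = begin-strict
    k * T + toℕ i  <⟨ +-monoʳ-< (k * T) (toℕ<n i) ⟩
    k * T + k      ≡⟨ +-comm (k * T) k ⟩
    k + k * T      ≡⟨ sym (*-suc k T) ⟩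
    k * suc T      ∎
    where open ≤-Reasoning

  code-bound : ∀ {T B} i → T < B → code T i < k * B
  code-bound {T} i T<B = <-≤-trans (code<k*[1+T] T i) (*-monoʳ-≤ k T<B)

  code-< : ∀ {T T′} i j → T < T′ → code T i < code T′ j
  code-< i j T<T′ = <-≤-trans (code-bound i T<T′) (m≤m+n _ (toℕ j))

  code-≤⇒≤ : ∀ {T T′} i j → code T i ≤ code T′ j → T ≤ T′
  code-≤⇒≤ i j c≤c′ = ≮⇒≥ (λ T′<T → <⇒≱ (code-< j i T′<T) c≤c′)

  Unnested : ℕ → ℕ → ℕ → ℕ → Set
  Unnested a b c d = a ≤ c → d ≤ b → a ≡ c × d ≡ b

  code-parallel : ∀ {i j a b c d} → i ≢ j → Unnested a b c d → Unnested c d a b →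
                  ¬ SegmentsIntersect (seg (code a i) (code b i)) (seg (code c j) (code d j))
  code-parallel {i} {j} i≢j nested _ (inj₁ (ai≤cj , dj≤bi))
    with nested (code-≤⇒≤ i j ai≤cj) (code-≤⇒≤ j i dj≤bi)
  ... | refl , refl = i≢j (toℕ-injective (≤-antisym (+-cancelˡ-≤ _ _ _ ai≤cj) (+-cancelˡ-≤ _ _ _ dj≤bi)))
  code-parallel {i} {j} i≢j _ nested′ (inj₂ (cj≤ai , bi≤dj))
    with nested′ (code-≤⇒≤ j i cj≤ai) (code-≤⇒≤ i j bi≤dj)
  ... | refl , refl = i≢j (toℕ-injective (≤-antisym (+-cancelˡ-≤ _ _ _ bi≤dj) (+-cancelˡ-≤ _ _ _ cj≤ai)))

  -- Arcs through x get odd keys and arcs avoiding x even ones, so mixed comparisons are strict.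
  odd : ℕ → ℕ
  odd a = suc (2 * a)

  even : ℕ → ℕ
  even a = 2 * a

  odd<even : ∀ {a b} → a < b → odd a < even b
  odd<even {a} {b} a<b = subst (_≤ 2 * b) (*-suc 2 a) (*-monoʳ-≤ 2 a<b)

  even<odd : ∀ {a b} → b ≤ a → even b < odd a
  even<odd b≤a = s≤s (*-monoʳ-≤ 2 b≤a)

  odd≤even⇒< : ∀ {a b} → odd a ≤ even b → a < b
  odd≤even⇒< le = ≰⇒> (λ b≤a → <⇒≱ (even<odd b≤a) le)

  even≤odd⇒≤ : ∀ {a b} → even b ≤ odd a → b ≤ a
  even≤odd⇒≤ le = ≮⇒≥ (λ a<b → <⇒≱ (odd<even a<b) le)

  unnested-odd : ∀ {a b c d} → Unnested a b c d → Unnested (odd a) (odd b) (odd c) (odd d)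
  unnested-odd nested a≤c d≤b =
    Product.map (cong odd) (cong odd) (nested (*-cancelˡ-≤ 2 (s≤s⁻¹ a≤c)) (*-cancelˡ-≤ 2 (s≤s⁻¹ d≤b)))

  unnested-even : ∀ {a b c d} → Unnested a b c d → Unnested (even a) (even b) (even c) (even d)
  unnested-even nested a≤c d≤b =
    Product.map (cong even) (cong even) (nested (*-cancelˡ-≤ 2 a≤c) (*-cancelˡ-≤ 2 d≤b))

  odd-even-crossing : ∀ {i j a b c d} → ¬ (c ≤ a × b < d) →
    (a < c × d ≤ b) ⇔ SegmentsIntersect (seg (code (odd a) i) (code (odd b) i)) (seg (code (even c) j) (code (even d) j))
  odd-even-crossing {i} {j} no-wrap = mk⇔
    (λ (a<c , d≤b) → inj₁ (<⇒≤ (code-< i j (odd<even a<c)) , <⇒≤ (code-< j i (even<odd d≤b))))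
    λ { (inj₁ (ai≤cj , dj≤bi)) → odd≤even⇒< (code-≤⇒≤ i j ai≤cj) , even≤odd⇒≤ (code-≤⇒≤ j i dj≤bi)
      ; (inj₂ (cj≤ai , bi≤dj)) →
          ⊥-elim (no-wrap (even≤odd⇒≤ (code-≤⇒≤ j i cj≤ai) , odd≤even⇒< (code-≤⇒≤ i j bi≤dj))) }

cheapest : ∀ {k p} {P : Pred (Fin k) p} → Decidable P → (cost : Fin k → ℕ) →
           ∃ P → ∃ λ j → P j × (∀ {i} → P i → cost j ≤ cost i)
cheapest {k} P? cost (i , Pi) =
  argmin cost i candidates ,
  argmin-all cost Pi (all-filter P? (allFin k)) ,
  λ Pi′ → All.lookup (f[argmin]≤f[xs] i candidates) (∈-filter⁺ P? (∈-allFin _) Pi′)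
  where
    candidates = filter P? (allFin k)

module ProperArcModel (G : Graph) (m′ : ℕ) (f : Fin (n G) → Arc)
                      (intersection : IsIntersectionGraph (ArcsIntersect m′) G f)
                      (proper : ∀ u v → ¬ ProperlyContains m′ (f u) (f v)) where
  open Arcs m′

  no-nesting : ∀ u v → ¬ f u ⊂ᵃ f v
  no-nesting u v u⊂v = proper v u (⊂ᵃ⇒ProperlyContains u⊂v)

  meet⇒adj : ∀ {u v} → u ≢ v → Meet (f u) (f v) → Adj G u v
  meet⇒adj {u} {v} u≢v = Equivalence.from (intersection u v u≢v) ∘ Equivalence.to meet⇔ArcsIntersect

  co-adj⇔disjoint : ∀ {u v} → u ≢ v → Adj (complement G) u v ⇔ (¬ Meet (f u) (f v))
  co-adj⇔disjoint {u} {v} u≢v = mk⇔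
    (λ (_ , ¬u~v) u∩v → ¬u~v (meet⇒adj u≢v u∩v))
    (λ u∩v≡∅ → u≢v , λ u~v →
      u∩v≡∅ (Equivalence.from meet⇔ArcsIntersect (Equivalence.to (intersection u v u≢v) u~v)))

  co-adj? : ∀ u v → Dec (Adj (complement G) u v)
  co-adj? u v with u ≟ᶠ v
  ... | yes u≡v = no λ (u≢v , _) → u≢v u≡v
  ... | no  u≢v = map′ (Equivalence.from (co-adj⇔disjoint u≢v)) (Equivalence.to (co-adj⇔disjoint u≢v))
                       (¬? (meet? (f u) (f v)))

  open Separations (complement G) co-adj? public using (Separation; disconnected⇒separation)

  AvoidersMeet : ℕ → Set
  AvoidersMeet x = ∀ p q → x ∉ᵃ f p → x ∉ᵃ f q → Meet (f p) (f q)

  module Separated (S : Separation) where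
    open Separation S

    cross-meet : ∀ {a c} → side a ≢ side c → Meet (f a) (f c)
    cross-meet {a} {c} sides = decidable-stable (meet? (f a) (f c)) λ a∩c≡∅ →
      no-crossing sides (Equivalence.from (co-adj⇔disjoint (λ { refl → sides refl })) a∩c≡∅)

    avoiders-of-nearest-start-meet : ∀ {u v w} → ¬ Meet (f u) (f v) → side u ≡ side v → side w ≢ side u →
      (∀ {c} → side c ≢ side u → en (f u) ∈ᵃ f c → δ (st (f w)) (en (f u)) ≤ δ (st (f c)) (en (f u))) →
      AvoidersMeet (st (f w))
    avoiders-of-nearest-start-meet {u} {v} {w} u∩v≡∅ su≡sv sw≢su nearest p q x∉p x∉q with side p Bool.≟ side q
    ... | no  sp≢sq = cross-meet sp≢sq
    ... | yes sp≡sq with side p Bool.≟ side u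
    ...   | yes sp≡su = en (f w) , same-side sp≡su x∉p , same-side (trans (sym sp≡sq) sp≡su) x∉q
      where
        same-side : ∀ {p} → side p ≡ side u → st (f w) ∉ᵃ f p → en (f w) ∈ᵃ f p
        same-side {p} sp≡su x∉p = [ (λ x∈p → ⊥-elim (x∉p x∈p)) , (λ ew∈p → ew∈p) ]′
          (meet-endpoint (cross-meet (subst (_≢ side w) (sym sp≡su) (≢-sym sw≢su))) (no-nesting p w))
    ...   | no  sp≢su = en (f v) , other-side sp≢su x∉p , other-side (subst (_≢ side u) sp≡sq sp≢su) x∉q
      where
        other-side : ∀ {p} → side p ≢ side u → st (f w) ∉ᵃ f p → en (f v) ∈ᵃ f p
        other-side {p} sp≢su x∉p =
          [ (λ eu∈p → ⊥-elim (x∉p (∈ᵃ-convex (st<M (f w)) eu∈p (nearest sp≢su eu∈p)))) , (λ ev∈p → ev∈p) ]′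
          (bridge-end (cross-meet sp≢su) (cross-meet (subst (side p ≢_) su≡sv sp≢su)) u∩v≡∅
                      (no-nesting p u) (no-nesting p v))

    point-from-bridge : ∀ {u v b₀} → ¬ Meet (f u) (f v) → side u ≡ side v →
                        side b₀ ≢ side u → en (f u) ∈ᵃ f b₀ → ∃ λ x → x < M × AvoidersMeet x
    point-from-bridge {u} u∩v≡∅ su≡sv sb₀≢su eu∈b₀
      with cheapest (λ c → ¬? (side c Bool.≟ side u) ×-dec en (f u) ∈ᵃ? f c) (λ c → δ (st (f c)) (en (f u)))
                    (_ , sb₀≢su , eu∈b₀)
    ... | w , (sw≢su , _) , nearest =
      st (f w) , st<M (f w) ,
      avoiders-of-nearest-start-meet u∩v≡∅ su≡sv sw≢su (λ sc≢su eu∈c → nearest (sc≢su , eu∈c))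

    point-from-disjoint-pair : ∀ {u v} → ¬ Meet (f u) (f v) → ∃ λ x → x < M × AvoidersMeet x
    point-from-disjoint-pair {u} {v} u∩v≡∅ with opposite u
    ... | b₀ , sb₀≢su =
      [ point-from-bridge u∩v≡∅ su≡sv sb₀≢su
      , point-from-bridge (u∩v≡∅ ∘ meet-sym) (sym su≡sv) sb₀≢sv ]′
      (bridge-end (cross-meet sb₀≢su) (cross-meet sb₀≢sv) u∩v≡∅ (no-nesting b₀ u) (no-nesting b₀ v))
      where
        su≡sv : side u ≡ side v
        su≡sv = decidable-stable (side u Bool.≟ side v) (u∩v≡∅ ∘ cross-meet)
        sb₀≢sv : side b₀ ≢ side v
        sb₀≢sv = subst (side b₀ ≢_) su≡sv sb₀≢su

    avoiders-meet-somewhere : ∃ λ x → x < M × AvoidersMeet x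
    avoiders-meet-somewhere with any? (λ u → any? (λ v → ¬? (meet? (f u) (f v))))
    ... | yes (u , v , u∩v≡∅) = point-from-disjoint-pair u∩v≡∅
    ... | no  all-meet =
      0 , z<s , λ p q _ _ → decidable-stable (meet? (f p) (f q)) (λ p∩q≡∅ → all-meet (p , q , p∩q≡∅))

  module Model {x} (x<M : x < M) (avoiders-meet : AvoidersMeet x) where
    open Codes (n G)

    A g : ∀ {w} → x ∈ᵃ f w → ℕ
    A {w} x∈w = Through.A (f w) x∈w
    g {w} x∈w = Through.g (f w) x∈w

    l r : ∀ {w} → x ∉ᵃ f w → ℕ
    l {w} x∉w = Avoiding.l (f w) x<M x∉w
    r {w} x∉w = Avoiding.r (f w) x<M x∉w

    segment : ∀ w → Dec (x ∈ᵃ f w) → Segment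
    segment w (yes x∈w) = seg (code (odd (A x∈w)) w) (code (odd (g x∈w)) w)
    segment w (no  x∉w) = seg (code (even (l x∉w)) w) (code (even (r x∉w)) w)

    meets-all⇒isolated : ∀ {w} → (∀ v → Meet (f w) (f v)) → Isolated (complement G) w
    meets-all⇒isolated meets v w~v = Equivalence.to (co-adj⇔disjoint (proj₁ w~v)) w~v (meets v)

    short : ∀ {w} → ¬ Isolated (complement G) w → Arc.len (f w) < m′
    short {w} ¬isolated = ≰⇒> λ m′≤len → ¬isolated (meets-all⇒isolated λ v →
      st (f v) , mk∈ (st<M (f v)) (≤-trans (s≤s⁻¹ (δ<M (st<M (f w)) (st<M (f v)))) m′≤len) , st∈ (f v))

    through-unnested : ∀ {u v} (x∈u : x ∈ᵃ f u) (x∈v : x ∈ᵃ f v) →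
      Arc.len (f u) < m′ → Arc.len (f v) < m′ →
      Unnested (A x∈u) (g x∈u) (A x∈v) (g x∈v)
    through-unnested {u} {v} x∈u x∈v short-u short-v Au≤Av gv≤gu =
      ≤-antisym Au≤Av Av≤Au , ≤-antisym gv≤gu gu≤gv
      where
        module U = Through (f u) x∈u
        module W = Through (f v) x∈v
        u⊆v : f u ⊆ᵃ f v
        u⊆v z∈u with U.∈⇒outside-gap z∈u
        ... | inj₁ z≤Au = W.outside-gap⇒∈ (on-circle z∈u) (inj₁ (≤-trans z≤Au Au≤Av))
        ... | inj₂ gu<z = W.outside-gap⇒∈ (on-circle z∈u) (inj₂ (≤-<-trans gv≤gu gu<z))
        Av≤Au : W.A ≤ U.A
        Av≤Au = ≮⇒≥ λ Au<Av → no-nesting u v (u⊆v , x ⊕ W.A ,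
          Equivalence.from (W.⊕∈⇔ Av<M) (inj₁ ≤-refl) ,
          λ Av∈u → [ <⇒≱ Au<Av , <-asym (<-≤-trans (W.A<g short-v) gv≤gu) ]′
                     (Equivalence.to (U.⊕∈⇔ Av<M) Av∈u))
          where
            Av<M = <-trans (W.A<g short-v) W.g<M
        gu≤gv : U.g ≤ W.g
        gu≤gv = ≮⇒≥ λ gv<gu → no-nesting u v (u⊆v , x ⊕ U.g ,
          Equivalence.from (W.⊕∈⇔ U.g<M) (inj₂ gv<gu) ,
          λ gu∈u → [ <⇒≱ (U.A<g short-u) , <-irrefl refl ]′ (Equivalence.to (U.⊕∈⇔ U.g<M) gu∈u))

    avoiding-unnested : ∀ {u v} (x∉u : x ∉ᵃ f u) (x∉v : x ∉ᵃ f v) →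
      Unnested (l x∉u) (r x∉u) (l x∉v) (r x∉v)
    avoiding-unnested {u} {v} x∉u x∉v lu≤lv rv≤ru = ≤-antisym lu≤lv lv≤lu , ≤-antisym rv≤ru ru≤rv
      where
        module U = Avoiding (f u) x<M x∉u
        module W = Avoiding (f v) x<M x∉v
        v⊆u : f v ⊆ᵃ f u
        v⊆u z∈v with W.∈⇒between z∈v
        ... | lv≤z , z≤rv = U.between⇒∈ (on-circle z∈v) (≤-trans lu≤lv lv≤z) (≤-trans z≤rv rv≤ru)
        lv≤lu : W.l ≤ U.l
        lv≤lu = ≮⇒≥ λ lu<lv → no-nesting v u (v⊆u , st (f u) , st∈ (f u) ,
          λ su∈v → <⇒≱ lu<lv (proj₁ (W.∈⇒between su∈v)))
        ru≤rv : U.r ≤ W.r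
        ru≤rv = ≮⇒≥ λ rv<ru → no-nesting v u (v⊆u , x ⊕ U.r ,
          Equivalence.from (U.⊕∈⇔ U.r<M) (m≤m+n U.l _ , ≤-refl) ,
          λ ru∈v → <⇒≱ rv<ru (proj₂ (Equivalence.to (W.⊕∈⇔ U.r<M) ru∈v)))

    disjoint⇔inside-gap : ∀ {u v} (x∈u : x ∈ᵃ f u) (x∉v : x ∉ᵃ f v) →
      (¬ Meet (f u) (f v)) ⇔ (A x∈u < l x∉v × r x∉v ≤ g x∈u)
    disjoint⇔inside-gap {u} {v} x∈u x∉v = mk⇔
      (λ u∩v≡∅ →
        ≰⇒> (λ lv≤Au → u∩v≡∅ (st (f v) , U.outside-gap⇒∈ (st<M (f v)) (inj₁ lv≤Au) , st∈ (f v))) ,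
        ≮⇒≥ (λ gu<rv → u∩v≡∅ (x ⊕ W.r , Equivalence.from (U.⊕∈⇔ W.r<M) (inj₂ gu<rv) ,
                                          Equivalence.from (W.⊕∈⇔ W.r<M) (m≤m+n W.l _ , ≤-refl))))
      inside-gap⇒disjoint
      where
        module U = Through (f u) x∈u
        module W = Avoiding (f v) x<M x∉v
        inside-gap⇒disjoint : U.A < W.l × W.r ≤ U.g → ¬ Meet (f u) (f v)
        inside-gap⇒disjoint (Au<lv , rv≤gu) (z , z∈u , z∈v) with W.∈⇒between z∈v | U.∈⇒outside-gap z∈u
        ... | lv≤z , _    | inj₁ z≤Au = <⇒≱ Au<lv (≤-trans lv≤z z≤Au)
        ... | _    , z≤rv | inj₂ gu<z = <⇒≱ gu<z (≤-trans z≤rv rv≤gu)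

    wrapping⇒meets-all : ∀ {u v} (x∈u : x ∈ᵃ f u) (x∉v : x ∉ᵃ f v) → Arc.len (f u) < m′ →
      l x∉v ≤ A x∈u → g x∈u < r x∉v →
      ∀ w → Meet (f u) (f w)
    wrapping⇒meets-all {u} {v} x∈u x∉v short-u lv≤Au gu<rv w =
      decidable-stable (meet? (f u) (f w)) (λ u∩w≡∅ → disjoint-absurd u∩w≡∅ (x ∈ᵃ? f w))
      where
        module U = Through (f u) x∈u
        module W = Avoiding (f v) x<M x∉v
        disjoint-absurd : ¬ Meet (f u) (f w) → Dec (x ∈ᵃ f w) → ⊥
        disjoint-absurd u∩w≡∅ (yes x∈w) = u∩w≡∅ (x , x∈u , x∈w)
        disjoint-absurd u∩w≡∅ (no  x∉w) =
          no-nesting w v (w⊆v , x ⊕ U.A , Au∈v ,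
                          λ Au∈w → <⇒≱ Au<lw (proj₁ (Equivalence.to (X.⊕∈⇔ Au<M) Au∈w)))
          where
            module X = Avoiding (f w) x<M x∉w
            Au<lw = proj₁ (Equivalence.to (disjoint⇔inside-gap x∈u x∉w) u∩w≡∅)
            rw≤gu = proj₂ (Equivalence.to (disjoint⇔inside-gap x∈u x∉w) u∩w≡∅)
            Au<M = <-trans (U.A<g short-u) U.g<M
            w⊆v : f w ⊆ᵃ f v
            w⊆v z∈w with X.∈⇒between z∈w
            ... | lw≤z , z≤rw = W.between⇒∈ (on-circle z∈w) (≤-trans lv≤Au (<⇒≤ (<-≤-trans Au<lw lw≤z)))
                                                              (≤-trans z≤rw (≤-trans rw≤gu (<⇒≤ gu<rv)))
            Au∈v : x ⊕ U.A ∈ᵃ f v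
            Au∈v = Equivalence.from (W.⊕∈⇔ Au<M) (lv≤Au , <⇒≤ (<-trans (U.A<g short-u) gu<rv))

    through-avoiding-model : ∀ {u v} → u ≢ v → ¬ Isolated (complement G) u →
      (x∈u : x ∈ᵃ f u) (x∉v : x ∉ᵃ f v) →
      Adj (complement G) u v ⇔ SegmentsIntersect (segment u (yes x∈u)) (segment v (no x∉v))
    through-avoiding-model u≢v ¬iso-u x∈u x∉v =
      ⇔-trans (co-adj⇔disjoint u≢v) (⇔-trans (disjoint⇔inside-gap x∈u x∉v) (odd-even-crossing
        λ (lv≤Au , gu<rv) → ¬iso-u (meets-all⇒isolated (wrapping⇒meets-all x∈u x∉v (short ¬iso-u) lv≤Au gu<rv))))

    non-isolated-model : ∀ {u v} → u ≢ v → ¬ Isolated (complement G) u → ¬ Isolated (complement G) v →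
      (du : Dec (x ∈ᵃ f u)) (dv : Dec (x ∈ᵃ f v)) →
      Adj (complement G) u v ⇔ SegmentsIntersect (segment u du) (segment v dv)
    non-isolated-model u≢v ¬iso-u ¬iso-v (yes x∈u) (yes x∈v) = mk⇔
      (λ u~v → ⊥-elim (Equivalence.to (co-adj⇔disjoint u≢v) u~v (x , x∈u , x∈v)))
      (λ crossing → ⊥-elim (code-parallel u≢v
        (unnested-odd (through-unnested x∈u x∈v (short ¬iso-u) (short ¬iso-v)))
        (unnested-odd (through-unnested x∈v x∈u (short ¬iso-v) (short ¬iso-u))) crossing))
    non-isolated-model {u} {v} u≢v _ _ (no x∉u) (no x∉v) = mk⇔
      (λ u~v → ⊥-elim (Equivalence.to (co-adj⇔disjoint u≢v) u~v (avoiders-meet u v x∉u x∉v)))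
      (λ crossing → ⊥-elim (code-parallel u≢v (unnested-even (avoiding-unnested x∉u x∉v))
                                               (unnested-even (avoiding-unnested x∉v x∉u)) crossing))
    non-isolated-model u≢v ¬iso-u _ (yes x∈u) (no x∉v) = through-avoiding-model u≢v ¬iso-u x∈u x∉v
    non-isolated-model u≢v _ ¬iso-v (no x∉u) (yes x∈v) = mk⇔
      (λ u~v → segments-intersect-sym (Equivalence.to model (adj-sym (complement G) u~v)))
      (λ crossing → adj-sym (complement G) (Equivalence.from model (segments-intersect-sym crossing)))
      where
        model = through-avoiding-model (≢-sym u≢v) ¬iso-v x∈v x∉u

    segment-below : ∀ {w} → ¬ Isolated (complement G) w → (d : Dec (x ∈ᵃ f w)) →
                    Below (n G * (2 * M)) (segment w d)
    segment-below {w} ¬iso (yes x∈w) =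
      code-bound w (odd<even (<-trans (U.A<g (short ¬iso)) U.g<M)) , code-bound w (odd<even U.g<M)
      where module U = Through (f w) x∈w
    segment-below {w} _ (no x∉w) =
      code-bound w (*-monoʳ-< 2 (≤-<-trans (m≤m+n W.l _) W.r<M)) , code-bound w (*-monoʳ-< 2 W.r<M)
      where module W = Avoiding (f w) x<M x∉w

    permutation-graph : PermutationGraph (complement G)
    permutation-graph = permutation-graph-off-isolated (complement G) (λ w → all? (λ v → ¬? (co-adj? w v)))
      (λ w → segment w (x ∈ᵃ? f w)) (n G * (2 * M))
      (λ {w} ¬iso → segment-below ¬iso (x ∈ᵃ? f w))
      (λ {u} {v} u≢v ¬iso-u ¬iso-v → non-isolated-model u≢v ¬iso-u ¬iso-v (x ∈ᵃ? f u) (x ∈ᵃ? f v))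

    bipartite : Bipartite (complement G)
    bipartite = (λ w → does (x ∈ᵃ? f w)) ,
      λ {u} {v} u~v → colours-differ (Equivalence.to (co-adj⇔disjoint (proj₁ u~v)) u~v) (x ∈ᵃ? f u) (x ∈ᵃ? f v)
      where
        colours-differ : ∀ {u v} → ¬ Meet (f u) (f v) → (du : Dec (x ∈ᵃ f u)) (dv : Dec (x ∈ᵃ f v)) →
                         does du ≢ does dv
        colours-differ u∩v≡∅ (yes x∈u) (yes x∈v) _ = u∩v≡∅ (x , x∈u , x∈v)
        colours-differ {u} {v} u∩v≡∅ (no x∉u) (no x∉v) _ = u∩v≡∅ (avoiders-meet u v x∉u x∉v)
        colours-differ _ (yes _) (no _) ()
        colours-differ _ (no _) (yes _) ()

proposition2p11 : (G : Graph) → ProperCircularArcGraph G → ¬ Connected (complement G) → BipartitePermutationGraph (complement G)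
proposition2p11 G (m′ , f , intersection , proper) ¬connected =
  let open ProperArcModel G m′ f intersection proper
      (x , x<M , avoiders-meet) = Separated.avoiders-meet-somewhere (disconnected⇒separation ¬connected)
      open Model x<M avoiders-meet
  in permutation-graph , bipartite
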